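{- Let $s,t$ be positive integers with $t = cs$ for some positive integer $c$, and let $F$ be a gerechte framework of order $n = st$ in which every region is either an $s \times t$ rectangle or a $t \times s$ rectangle. Then $F$ is realizable.
   Context: A gerechte framework of order $n$ is a partition of the cells of an $n\times n$ array into $n$ regions, each containing $n$ cells. A latin square of order $n$ is an $n\times n$ array with symbols $1,\dots,n$ in which each symbol appears exactly once in each row and once in each column. A latin square realizes a gerechte framework if, when its cells are partitioned by the framework, each region contains each symbol exactly once; a framework with such a latin square is called realizable. A region is an $a\times b$ rectangle if it consists of the cells lying in some $a$ consecutive rows and some $b$ consecutive columns (height $a$, width $b$). -}

module Defs where

open import Data.Nat using (ℕ; _+_; _*_; _≤_; _<_)
open import Data.Fin using (Fin; toℕ)
open import Data.Fin.Properties using (_≟_)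
open import Data.Product using (_×_; _,_; Σ; ∃; ∃-syntax)
open import Data.List using (List; length; filter; cartesianProduct; allFin)
open import Relation.Binary.PropositionalEquality using (_≡_)
open import Relation.Nullary using (Dec)
open import Relation.Nullary.Decidable using (_×-dec_)
open import Function.Bundles using (_⇔_)

-- A cell of an n×n array: (row , column).
Cell : ℕ → Set
Cell n = Fin n × Fin n

cells : (n : ℕ) → List (Cell n)
cells n = cartesianProduct (allFin n) (allFin n)

-- A partition of the cells into n regions (labelled by Fin n) is given by
-- the labelling function assigning to each cell its region.
-- Number of cells in region r:
regionSize : {n : ℕ} → (Fin n → Fin n → Fin n) → Fin n → ℕ
regionSize {n} reg r = length (filter (λ c → reg (Data.Product.proj₁ c) (Data.Product.proj₂ c) ≟ r) (cells n))

record GerechteFramework (n : ℕ) : Set where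
  field
    region : Fin n → Fin n → Fin n
    size   : ∀ r → regionSize region r ≡ n
open GerechteFramework public

record LatinSquare (n : ℕ) : Set where
  field
    entry   : Fin n → Fin n → Fin n
    rowOnce : ∀ i k → ∃[ j ] (entry i j ≡ k × (∀ j' → entry i j' ≡ k → j' ≡ j))
    colOnce : ∀ j k → ∃[ i ] (entry i j ≡ k × (∀ i' → entry i' j ≡ k → i' ≡ i))
open LatinSquare public

Realizes : {n : ℕ} → LatinSquare n → GerechteFramework n → Set
Realizes {n} L F =
  ∀ (r k : Fin n) → ∃[ c ] ((region F (Data.Product.proj₁ c) (Data.Product.proj₂ c) ≡ r
                             × entry L (Data.Product.proj₁ c) (Data.Product.proj₂ c) ≡ k)
      × (∀ (c' : Cell n) → region F (Data.Product.proj₁ c') (Data.Product.proj₂ c') ≡ r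
                         → entry L (Data.Product.proj₁ c') (Data.Product.proj₂ c') ≡ k
                         → c' ≡ c))

Realizable : {n : ℕ} → GerechteFramework n → Set
Realizable {n} F = Σ (LatinSquare n) (λ L → Realizes L F)

IsRectangle : {n : ℕ} → GerechteFramework n → Fin n → ℕ → ℕ → Set
IsRectangle {n} F r a b =
  ∃[ i0 ] ∃[ j0 ] (i0 + a ≤ n × j0 + b ≤ n ×
    (∀ (i j : Fin n) → (region F i j ≡ r) ⇔
        ((i0 ≤ toℕ i × toℕ i < i0 + a) × (j0 ≤ toℕ j × toℕ j < j0 + b))))

-- Cut the array into s×s blocks: cell (i , j) lies in block (i / s , j / s), a point of
-- ℤ_t × ℤ_t, at offset (i % s , j % s). Write the block's diagonal (i / s + j / s) mod t as
-- z + a·c with z < c and a < s, and give the cell the symbol (z , (i % s + a) mod s ,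
-- (j % s + a) mod s) ∈ ℤ_c × ℤ_s × ℤ_s, a set of c·s·s = n symbols. Within a row the second
-- coordinate recovers a, hence the diagonal, hence the block column, and the third coordinate
-- the offset; transposing swaps the last two coordinates, which handles columns.
-- Every region is aligned to the s-grid: the region containing the cell just above a region's
-- top-left corner must end exactly on that row, so by induction on rows every top edge is a
-- sum of heights, all multiples of s (and symmetrically for left edges). An aligned s×t region
-- is one block row met by c consecutive block columns, on which z ≡ i / s + j / s (mod c)
-- recovers the block; a t×s region is the transpose.
module Submission where

open import Defs
open import Data.Nat
open import Data.Nat.Properties
open import Data.Nat.DivMod
open import Data.Nat.Divisibility using (_∣_; divides; _∣0; ∣-refl; ∣m∣n⇒∣m+n; m∣m*n)
open import Data.Nat.Induction using (<-rec)
open import Data.Fin using (Fin; toℕ; fromℕ<; punchOut)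
open import Data.Fin.Properties
  using (toℕ-fromℕ<; toℕ-injective; toℕ<n; fromℕ<-injective; any?; pigeonhole; punchOut-injective)
  renaming (_≟_ to _≟ᶠ_; <⇒≢ to <ᶠ⇒≢)
open import Data.Product using (∃-syntax; _×_; _,_; proj₁; proj₂; swap; uncurry)
open import Data.Sum using (_⊎_; inj₁; inj₂; [_,_])
open import Function.Base using (flip; _∘_)
open import Function.Bundles using (_⇔_; mk⇔; Equivalence)
open import Function.Definitions using (Injective; StrictlySurjective)
open import Relation.Binary.PropositionalEquality
  using (_≡_; _≢_; refl; sym; trans; cong; cong₂; subst; subst₂; module ≡-Reasoning)
open import Relation.Nullary using (¬_; yes; no; contradiction)

open Equivalence using (to; from)

Between : ℕ → ℕ → ℕ → Set
Between lo len x = lo ≤ x × x < lo + len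

%-/-injective : ∀ d .{{_ : NonZero d}} {x y} → x % d ≡ y % d → x / d ≡ y / d → x ≡ y
%-/-injective d {x} {y} x%d≡y%d x/d≡y/d = begin
  x                   ≡⟨ m≡m%n+[m/n]*n x d ⟩
  x % d + (x / d) * d ≡⟨ cong₂ (λ r q → r + q * d) x%d≡y%d x/d≡y/d ⟩
  y % d + (y / d) * d ≡⟨ m≡m%n+[m/n]*n y d ⟨
  y                   ∎
  where open ≡-Reasoning

%-injective-< : ∀ d .{{_ : NonZero d}} {x y} → x ≤ y → y < x + d → x % d ≡ y % d → x ≡ y
%-injective-< d {x} {y} x≤y y<x+d x%d≡y%d = ≤-antisym x≤y (m∸n≡0⇒m≤n y∸x≡0)
  where
  open ≡-Reasoning
  y∸x≡q*d : y ∸ x ≡ (y / d ∸ x / d) * d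
  y∸x≡q*d = begin
    y ∸ x                                     ≡⟨ cong₂ _∸_ (m≡m%n+[m/n]*n y d) (m≡m%n+[m/n]*n x d) ⟩
    (y % d + y / d * d) ∸ (x % d + x / d * d) ≡⟨ cong (λ r → (y % d + y / d * d) ∸ (r + x / d * d)) x%d≡y%d ⟩
    (y % d + y / d * d) ∸ (y % d + x / d * d) ≡⟨ [m+n]∸[m+o]≡n∸o (y % d) (y / d * d) (x / d * d) ⟩
    y / d * d ∸ x / d * d                     ≡⟨ *-distribʳ-∸ d (y / d) (x / d) ⟨
    (y / d ∸ x / d) * d                       ∎
  y∸x≡0 : y ∸ x ≡ 0
  y∸x≡0 = trans y∸x≡q*d (cong (_* d) (n<1⇒n≡0 (*-cancelʳ-< d (y / d ∸ x / d) 1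
    (subst₂ _<_ y∸x≡q*d (sym (*-identityˡ d)) (m<n+o⇒m∸n<o y x y<x+d)))))

%-injective-between : ∀ d .{{_ : NonZero d}} {b x y} →
  Between b d x → Between b d y → x % d ≡ y % d → x ≡ y
%-injective-between d {b} {x} {y} (b≤x , x<b+d) (b≤y , y<b+d) eq with ≤-total x y
... | inj₁ x≤y = %-injective-< d x≤y (<-≤-trans y<b+d (+-monoˡ-≤ d b≤x)) eq
... | inj₂ y≤x = sym (%-injective-< d y≤x (<-≤-trans x<b+d (+-monoˡ-≤ d b≤y)) (sym eq))

+-cancelˡ-% : ∀ d .{{_ : NonZero d}} a {x y} → x < d → y < d → (a + x) % d ≡ (a + y) % d → x ≡ y
+-cancelˡ-% d a x<d y<d eq = +-cancelˡ-≡ a _ _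
  (%-injective-between d (m≤m+n a _ , +-monoʳ-< a x<d) (m≤m+n a _ , +-monoʳ-< a y<d) eq)

+-cancelʳ-% : ∀ d .{{_ : NonZero d}} a {x y} → x < d → y < d → (x + a) % d ≡ (y + a) % d → x ≡ y
+-cancelʳ-% d a {x} {y} x<d y<d eq =
  +-cancelˡ-% d a x<d y<d (trans (cong (_% d) (+-comm a x)) (trans eq (cong (_% d) (+-comm y a))))

+-*-injective : ∀ d .{{_ : NonZero d}} {x y q r} → x < d → y < d →
  x + q * d ≡ y + r * d → x ≡ y × q ≡ r
+-*-injective d {x} {y} {q} {r} x<d y<d eq =
  x≡y , *-cancelʳ-≡ q r d (+-cancelˡ-≡ x _ _ (trans eq (cong (_+ r * d) (sym x≡y))))
  where
  open ≡-Reasoning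
  x≡y : x ≡ y
  x≡y = begin
    x               ≡⟨ m<n⇒m%n≡m x<d ⟨
    x % d           ≡⟨ [m+kn]%n≡m%n x q d ⟨
    (x + q * d) % d ≡⟨ cong (_% d) eq ⟩
    (y + r * d) % d ≡⟨ [m+kn]%n≡m%n y r d ⟩
    y % d           ≡⟨ m<n⇒m%n≡m y<d ⟩
    y               ∎

/-between : ∀ d .{{_ : NonZero d}} {k m x} → Between (k * d) (m * d) x → Between k m (x / d)
/-between d {k} {m} {x} (kd≤x , x<kd+md) =
  subst (_≤ x / d) (m*n/n≡m k d) (/-monoˡ-≤ d kd≤x) ,
  m<n*o⇒m/o<n (subst (x <_) (sym (*-distribʳ-+ d k m)) x<kd+md)

/-between-once : ∀ d .{{_ : NonZero d}} {k x} → Between (k * d) d x → x / d ≡ k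
/-between-once d {k} {x} x∈
  with k≤x/d , x/d<k+1 ← /-between d {m = 1} (subst (λ len → Between (k * d) len x) (sym (*-identityˡ d)) x∈)
  = ≤-antisym (s≤s⁻¹ (subst (x / d <_) (+-comm k 1) x/d<k+1)) k≤x/d

between-+ˡ : ∀ a {b len x} → Between b len x → Between (a + b) len (a + x)
between-+ˡ a {b} {len} {x} (b≤x , x<b+len) =
  +-monoʳ-≤ a b≤x , subst (a + x <_) (sym (+-assoc a b len)) (+-monoʳ-< a x<b+len)

injective⇒strictlySurjective : ∀ {n} {f : Fin n → Fin n} →
  Injective _≡_ _≡_ f → StrictlySurjective _≡_ f
injective⇒strictlySurjective {suc m} {f} f-inj k with any? (λ x → f x ≟ᶠ k)
... | yes hit = hit
... | no miss
  with i , j , i<j , eq ← pigeonhole (n<1+n m) (λ x → punchOut (λ k≡fx → miss (x , sym k≡fx)))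
  = contradiction (f-inj (punchOut-injective (λ e → miss (i , sym e)) (λ e → miss (j , sym e)) eq)) (<ᶠ⇒≢ i<j)

injective⇒unique-preimage : ∀ {n} {f : Fin n → Fin n} → Injective _≡_ _≡_ f →
  ∀ k → ∃[ x ] (f x ≡ k × (∀ x' → f x' ≡ k → x' ≡ x))
injective⇒unique-preimage f-inj k with x , fx≡k ← injective⇒strictlySurjective f-inj k
  = x , fx≡k , λ x' fx'≡k → f-inj (trans fx'≡k (sym fx≡k))

InRect : ℕ → ℕ → ℕ → ℕ → ℕ → ℕ → Set
InRect top left height width i j = Between top height i × Between left width j

record Rectangle {n} {Reg : Set} (R : Fin n → Fin n → Reg) (r : Reg) : Set where
  field
    top left height width : ℕ
    0<height : 0 < height
    0<width  : 0 < width
    bottom≤n : top + height ≤ n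
    right≤n  : left + width ≤ n
    mem      : ∀ i j → (R i j ≡ r) ⇔ InRect top left height width (toℕ i) (toℕ j)
open Rectangle

transpose : ∀ {n} {Reg : Set} {R : Fin n → Fin n → Reg} {r} → Rectangle R r → Rectangle (flip R) r
transpose ρ = record
  { top = left ρ ; left = top ρ ; height = width ρ ; width = height ρ
  ; 0<height = 0<width ρ ; 0<width = 0<height ρ
  ; bottom≤n = right≤n ρ ; right≤n = bottom≤n ρ
  ; mem = λ i j → mk⇔ (swap ∘ to (mem ρ j i)) (from (mem ρ j i) ∘ swap)
  }

module Tiling {n} {Reg : Set} {R : Fin n → Fin n → Reg} (rect : ∀ r → Rectangle R r) where

  region-change⇒bottom-edge : ∀ {r} (a b col : Fin n) → toℕ b ≡ suc (toℕ a) → R b col ≡ r → R a col ≢ r →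
    top (rect (R a col)) + height (rect (R a col)) ≡ toℕ b
  region-change⇒bottom-edge a b col b≡1+a b∈r a∉r =
    ≤-antisym (≮⇒≥ b∉ρ) (subst (_≤ top ρ + height ρ) (sym b≡1+a) a<end)
    where
    ρ : Rectangle R (R a col)
    ρ = rect (R a col)
    a∈ρ : InRect (top ρ) (left ρ) (height ρ) (width ρ) (toℕ a) (toℕ col)
    a∈ρ = to (mem ρ a col) refl
    a<end : toℕ a < top ρ + height ρ
    a<end = proj₂ (proj₁ a∈ρ)
    b∉ρ : ¬ toℕ b < top ρ + height ρ
    b∉ρ b<end = a∉r (trans (sym (from (mem ρ b col) (b-row , proj₂ a∈ρ))) b∈r)
      where
      b-row : Between (top ρ) (height ρ) (toℕ b)
      b-row = subst (top ρ ≤_) (sym b≡1+a) (m≤n⇒m≤1+n (proj₁ (proj₁ a∈ρ))) , b<end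

  top-edge⇒bottom-edge-above : ∀ r {k} → top (rect r) ≡ suc k → ∃[ r' ] top (rect r') + height (rect r') ≡ suc k
  top-edge⇒bottom-edge-above r {k} top≡1+k =
    R a col , trans (region-change⇒bottom-edge a b col (trans b≡1+k (cong suc (sym a≡k))) b∈r a∉r) b≡1+k
    where
    ρ : Rectangle R r
    ρ = rect r
    1+k<n : suc k < n
    1+k<n = ≤-trans (subst (λ x → x < top ρ + height ρ) top≡1+k (m<m+n _ (0<height ρ))) (bottom≤n ρ)
    a b col : Fin n
    a = fromℕ< (<-trans (n<1+n k) 1+k<n)
    b = fromℕ< 1+k<n
    col = fromℕ< (≤-trans (m<m+n _ (0<width ρ)) (right≤n ρ))
    a≡k : toℕ a ≡ k
    a≡k = toℕ-fromℕ< _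
    b≡1+k : toℕ b ≡ suc k
    b≡1+k = toℕ-fromℕ< _
    col∈ρ : Between (left ρ) (width ρ) (toℕ col)
    col∈ρ = subst (Between (left ρ) (width ρ)) (sym (toℕ-fromℕ< _)) (≤-refl , m<m+n _ (0<width ρ))
    b∈r : R b col ≡ r
    b∈r = from (mem ρ b col)
      (subst (Between (top ρ) (height ρ)) (sym (trans b≡1+k (sym top≡1+k))) (≤-refl , m<m+n _ (0<height ρ)) , col∈ρ)
    a∉r : R a col ≢ r
    a∉r a∈r = n≮n k (subst₂ _≤_ top≡1+k a≡k (proj₁ (proj₁ (to (mem ρ a col) a∈r))))

  top-aligned : ∀ {s} → (∀ r → s ∣ height (rect r)) → ∀ r → s ∣ top (rect r)
  top-aligned {s} s∣height r = <-rec P step (top (rect r)) r refl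
    where
    P : ℕ → Set _
    P k = ∀ r → top (rect r) ≡ k → s ∣ k
    step : ∀ k → (∀ {k'} → k' < k → P k') → P k
    step zero    _   _ _       = s ∣0
    step (suc k) rec r top≡1+k =
      let r' , end≡1+k = top-edge⇒bottom-edge-above r top≡1+k in
      subst (s ∣_) end≡1+k (∣m∣n⇒∣m+n
        (rec (subst (top (rect r') <_) end≡1+k (m<m+n _ (0<height (rect r')))) r' refl)
        (s∣height r'))

left-aligned : ∀ {n} {Reg : Set} {R : Fin n → Fin n → Reg} (rect : ∀ r → Rectangle R r) {s} →
  (∀ r → s ∣ width (rect r)) → ∀ r → s ∣ left (rect r)
left-aligned rect = Tiling.top-aligned (transpose ∘ rect)

module _ {n} {Reg : Set} {R : Fin n → Fin n → Reg} {r} (ρ : Rectangle R r) (area : height ρ * width ρ ≡ n) where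

  private instance
    width≢0 : NonZero (width ρ)
    width≢0 = >-nonZero (0<width ρ)

  private
    row-offset<height : (m : Fin n) → toℕ m / width ρ < height ρ
    row-offset<height m = m<n*o⇒m/o<n (subst (toℕ m <_) (sym area) (toℕ<n m))

    row<n : (m : Fin n) → top ρ + toℕ m / width ρ < n
    row<n m = <-≤-trans (+-monoʳ-< (top ρ) (row-offset<height m)) (bottom≤n ρ)

    col<n : (m : Fin n) → left ρ + toℕ m % width ρ < n
    col<n m = <-≤-trans (+-monoʳ-< (left ρ) (m%n<n (toℕ m) (width ρ))) (right≤n ρ)

    enumerate : Fin n → Fin n × Fin n
    enumerate m = fromℕ< (row<n m) , fromℕ< (col<n m)

    enumerate-∈ : ∀ m → R (proj₁ (enumerate m)) (proj₂ (enumerate m)) ≡ r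
    enumerate-∈ m = from (mem ρ _ _)
      ( subst (Between (top ρ) (height ρ)) (sym (toℕ-fromℕ< (row<n m)))
          (m≤m+n _ _ , +-monoʳ-< (top ρ) (row-offset<height m))
      , subst (Between (left ρ) (width ρ)) (sym (toℕ-fromℕ< (col<n m)))
          (m≤m+n _ _ , +-monoʳ-< (left ρ) (m%n<n (toℕ m) (width ρ))) )

    enumerate-injective : Injective _≡_ _≡_ enumerate
    enumerate-injective {m} {m'} eq = toℕ-injective (%-/-injective (width ρ)
      (+-cancelˡ-≡ (left ρ) _ _ (fromℕ<-injective _ _ (col<n m) (col<n m') (cong proj₂ eq)))
      (+-cancelˡ-≡ (top ρ) _ _ (fromℕ<-injective _ _ (row<n m) (row<n m') (cong proj₁ eq))))

  unique-in-rectangle : (E : Fin n → Fin n → Fin n) →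
    (∀ {i j i' j'} → R i j ≡ r → R i' j' ≡ r → E i j ≡ E i' j' → (i , j) ≡ (i' , j')) →
    ∀ k → ∃[ c ] ((R (proj₁ c) (proj₂ c) ≡ r × E (proj₁ c) (proj₂ c) ≡ k)
      × (∀ (c' : Fin n × Fin n) → R (proj₁ c') (proj₂ c') ≡ r → E (proj₁ c') (proj₂ c') ≡ k → c' ≡ c))
  unique-in-rectangle E E-inj k =
    let m , Em≡k = injective⇒strictlySurjective E∘enumerate-injective k in
    enumerate m , (enumerate-∈ m , Em≡k) ,
    λ c' c'∈r Ec'≡k → E-inj c'∈r (enumerate-∈ m) (trans Ec'≡k (sym Em≡k))
    where
    E∘enumerate-injective : Injective _≡_ _≡_ (uncurry E ∘ enumerate)
    E∘enumerate-injective eq = enumerate-injective (E-inj (enumerate-∈ _) (enumerate-∈ _) eq)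

+-*-< : ∀ {d m x q} → x < d → q < m → x + q * d < m * d
+-*-< {d} {m} {x} {q} x<d q<m = ≤-trans (+-monoˡ-≤ (q * d) x<d) (*-monoˡ-≤ d q<m)

module LatinCode (s c : ℕ) {{_ : NonZero s}} {{_ : NonZero c}} where

  t : ℕ
  t = c * s

  instance
    t≢0 : NonZero t
    t≢0 = m*n≢0 c s

  diagonal : ℕ → ℕ → ℕ
  diagonal i j = (i / s + j / s) % t

  digit : ℕ → ℕ → ℕ
  digit u d = (u + d / c) % s

  code₀ code₁ code₂ : ℕ → ℕ → ℕ
  code₀ i j = diagonal i j % c
  code₁ i j = digit (i % s) (diagonal i j)
  code₂ i j = digit (j % s) (diagonal i j)

  symbol : ℕ → ℕ → ℕ
  symbol i j = code₀ i j + code₁ i j * c + code₂ i j * t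

  SameCode : ℕ → ℕ → ℕ → ℕ → Set
  SameCode i j i' j' = code₀ i j ≡ code₀ i' j' × code₁ i j ≡ code₁ i' j' × code₂ i j ≡ code₂ i' j'

  code₀+code₁*c<t : ∀ i j → code₀ i j + code₁ i j * c < t
  code₀+code₁*c<t i j = subst (code₀ i j + code₁ i j * c <_) (*-comm s c)
    (+-*-< (m%n<n (diagonal i j) c) (m%n<n (i % s + diagonal i j / c) s))

  symbol<s*t : ∀ i j → symbol i j < s * t
  symbol<s*t i j = +-*-< (code₀+code₁*c<t i j) (m%n<n (j % s + diagonal i j / c) s)

  symbol-injective : ∀ {i j i' j'} → symbol i j ≡ symbol i' j' → SameCode i j i' j'
  symbol-injective {i} {j} {i'} {j'} eq =
    let low≡ , e₂ = +-*-injective t (code₀+code₁*c<t i j) (code₀+code₁*c<t i' j') eq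
        e₀ , e₁ = +-*-injective c (m%n<n (diagonal i j) c) (m%n<n (diagonal i' j') c) low≡
    in e₀ , e₁ , e₂

  diagonal/c<s : ∀ i j → diagonal i j / c < s
  diagonal/c<s i j = m<n*o⇒m/o<n (subst (diagonal i j <_) (*-comm c s) (m%n<n _ t))

  /s<t : ∀ {i} → i < s * t → i / s < t
  /s<t {i} i<n = m<n*o⇒m/o<n (subst (i <_) (*-comm s t) i<n)

  same-block⇒≡ : ∀ {i j i' j'} → SameCode i j i' j' → i / s ≡ i' / s → j / s ≡ j' / s → i ≡ i' × j ≡ j'
  same-block⇒≡ {i} {j} {i'} {j'} (_ , e₁ , e₂) i/s≡ j/s≡ =
    %-/-injective s (offset≡ e₁ (m%n<n i s) (m%n<n i' s)) i/s≡ ,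
    %-/-injective s (offset≡ e₂ (m%n<n j s) (m%n<n j' s)) j/s≡
    where
    shift≡ : diagonal i j / c ≡ diagonal i' j' / c
    shift≡ = cong (λ d → d / c) (cong₂ (λ I J → (I + J) % t) i/s≡ j/s≡)
    offset≡ : ∀ {u u'} → digit u (diagonal i j) ≡ digit u' (diagonal i' j') → u < s → u' < s → u ≡ u'
    offset≡ {u} {u'} e u<s u'<s =
      +-cancelʳ-% s (diagonal i j / c) u<s u'<s (trans e (cong (λ a → (u' + a) % s) (sym shift≡)))

  row-injective : ∀ {i j j'} → j < s * t → j' < s * t → SameCode i j i j' → j ≡ j'
  row-injective {i} {j} {j'} j<n j'<n code@(e₀ , e₁ , _) = proj₂ (same-block⇒≡ code refl j/s≡)
    where
    shift≡ : diagonal i j / c ≡ diagonal i j' / c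
    shift≡ = +-cancelˡ-% s (i % s) (diagonal/c<s i j) (diagonal/c<s i j') e₁
    j/s≡ : j / s ≡ j' / s
    j/s≡ = +-cancelˡ-% t (i / s) (/s<t j<n) (/s<t j'<n) (%-/-injective c e₀ shift≡)

  diagonal-comm : ∀ i j → diagonal j i ≡ diagonal i j
  diagonal-comm i j = cong (_% t) (+-comm (j / s) (i / s))

  SameCode-transpose : ∀ {i j i' j'} → SameCode i j i' j' → SameCode j i j' i'
  SameCode-transpose {i} {j} {i'} {j'} (e₀ , e₁ , e₂) =
    transposed (_% c) (_% c) e₀ , transposed (digit (j % s)) (digit (j' % s)) e₂ ,
    transposed (digit (i % s)) (digit (i' % s)) e₁
    where
    transposed : (f g : ℕ → ℕ) → f (diagonal i j) ≡ g (diagonal i' j') → f (diagonal j i) ≡ g (diagonal j' i')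
    transposed f g e = trans (cong f (diagonal-comm i j)) (trans e (cong g (sym (diagonal-comm i' j'))))

  column-injective : ∀ {i i' j} → i < s * t → i' < s * t → SameCode i j i' j → i ≡ i'
  column-injective i<n i'<n code = row-injective i<n i'<n (SameCode-transpose code)

  aligned-block-injective : ∀ {top left i j i' j'} → s ∣ top → s ∣ left →
    InRect top left s t i j → InRect top left s t i' j' → SameCode i j i' j' → i ≡ i' × j ≡ j'
  aligned-block-injective {i = i} {j} {i'} {j'} (divides I refl) (divides J refl) (i∈ , j∈) (i'∈ , j'∈)
                          code@(e₀ , _) = same-block⇒≡ code i/s≡ j/s≡
    where
    i/s≡ : i / s ≡ i' / s
    i/s≡ = trans (/-between-once s {I} i∈) (sym (/-between-once s {I} i'∈))
    code₀≡ : ∀ i j → code₀ i j ≡ (i / s + j / s) % c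
    code₀≡ i j = m∣n⇒o%n%m≡o%m c t (i / s + j / s) (m∣m*n s)
    j/s≡ : j / s ≡ j' / s
    j/s≡ = +-cancelˡ-≡ (i / s) _ _ (%-injective-between c
      (between-+ˡ (i / s) (/-between s {J} {c} j∈))
      (between-+ˡ (i / s) (/-between s {J} {c} j'∈))
      (trans (sym (code₀≡ i j)) (trans e₀ (trans (code₀≡ i' j') (cong (λ I → (I + j' / s) % c) (sym i/s≡))))))

toRectangle : ∀ {n} {F : GerechteFramework n} {r a b} → 0 < a → 0 < b → IsRectangle F r a b → Rectangle (region F) r
toRectangle 0<a 0<b (i0 , j0 , i0+a≤n , j0+b≤n , mem) = record
  { top = i0 ; left = j0 ; height = _ ; width = _ ; 0<height = 0<a ; 0<width = 0<b
  ; bottom≤n = i0+a≤n ; right≤n = j0+b≤n ; mem = mem }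

module Realization (s c : ℕ) {{_ : NonZero s}} {{_ : NonZero c}} where
  open LatinCode s c

  n : ℕ
  n = s * t

  latinEntry : Fin n → Fin n → Fin n
  latinEntry i j = fromℕ< (symbol<s*t (toℕ i) (toℕ j))

  latinEntry⇒SameCode : ∀ {i j i' j'} → latinEntry i j ≡ latinEntry i' j' →
    SameCode (toℕ i) (toℕ j) (toℕ i') (toℕ j')
  latinEntry⇒SameCode eq = symbol-injective (fromℕ<-injective _ _ _ _ eq)

  latin : LatinSquare n
  latin = record
    { entry   = latinEntry
    ; rowOnce = λ i → injective⇒unique-preimage λ eq →
        toℕ-injective (row-injective (toℕ<n _) (toℕ<n _) (latinEntry⇒SameCode eq))
    ; colOnce = λ j → injective⇒unique-preimage λ eq →
        toℕ-injective (column-injective (toℕ<n _) (toℕ<n _) (latinEntry⇒SameCode eq))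
    }

  s∣t : s ∣ t
  s∣t = divides c refl

  module _ (F : GerechteFramework n) (shape : ∀ r → IsRectangle F r s t ⊎ IsRectangle F r t s) where

    rect : ∀ r → Rectangle (region F) r
    rect r = [ toRectangle {F = F} (>-nonZero⁻¹ s) (>-nonZero⁻¹ t)
             , toRectangle {F = F} (>-nonZero⁻¹ t) (>-nonZero⁻¹ s) ] (shape r)

    s∣height : ∀ r → s ∣ height (rect r)
    s∣height r with shape r
    ... | inj₁ _ = ∣-refl
    ... | inj₂ _ = s∣t

    s∣width : ∀ r → s ∣ width (rect r)
    s∣width r with shape r
    ... | inj₁ _ = s∣t
    ... | inj₂ _ = ∣-refl

    latinEntry-injective-in : ∀ r {i j i' j'} → region F i j ≡ r → region F i' j' ≡ r →
      latinEntry i j ≡ latinEntry i' j' → (i , j) ≡ (i' , j')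
    latinEntry-injective-in r ij∈r i'j'∈r eq
      with shape r | Tiling.top-aligned rect s∣height r | left-aligned rect s∣width r
    ... | inj₁ (_ , _ , _ , _ , mem) | s∣top | s∣left =
      let i≡ , j≡ = aligned-block-injective s∣top s∣left (to (mem _ _) ij∈r) (to (mem _ _) i'j'∈r)
                      (latinEntry⇒SameCode eq)
      in cong₂ _,_ (toℕ-injective i≡) (toℕ-injective j≡)
    ... | inj₂ (_ , _ , _ , _ , mem) | s∣top | s∣left =
      let j≡ , i≡ = aligned-block-injective s∣left s∣top (swap (to (mem _ _) ij∈r)) (swap (to (mem _ _) i'j'∈r))
                      (SameCode-transpose (latinEntry⇒SameCode eq))
      in cong₂ _,_ (toℕ-injective i≡) (toℕ-injective j≡)

    realizable : Realizable F
    realizable = latin , λ r → unique-in-rectangle (rect r) (area r) latinEntry (latinEntry-injective-in r)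
      where
      area : ∀ r → height (rect r) * width (rect r) ≡ n
      area r with shape r
      ... | inj₁ _ = refl
      ... | inj₂ _ = *-comm t s

theorem6 : (s t c : ℕ) → NonZero s → NonZero t → NonZero c → t ≡ c * s →
    (F : GerechteFramework (s * t)) →
    (∀ r → IsRectangle F r s t ⊎ IsRectangle F r t s) →
    Realizable F
theorem6 s .(c * s) c s≢0 _ c≢0 refl = Realization.realizable s c {{s≢0}} {{c≢0}}
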